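{- Every Past LTL formula $\varphi$ admits an equivalent automata cascade with a number of components linear in the size of $\varphi$, each of whose components is either a trivial automaton or an automaton whose semiautomaton is a flip-flop semiautomaton composed with an input function. Equivalence means the cascade is an automaton on assignments reading assignments to the variables of $\varphi$ and having an output variable $a$ such that for every interpretation $I$ and time $t$, $(I,t)\models\varphi$ iff $(C,I,t)\vdash a$.
   Context: Past LTL formulas are built from propositional variables and $\top,\bot$ using $\neg,\land,\lor$, the before operator $\ominus$ and the since operator $\mathsf{S}$. Interpretations are finite non-empty sequences $I=I_1,\dots,I_\ell$ of sets of variables; $(I,t)\models a$ iff $a\in I_t$; Boolean connectives as usual; $(I,t)\models\ominus\alpha$ iff $(I,t-1)\models\alpha$; $(I,t)\models\alpha\,\mathsf{S}\,\beta$ iff there is $j\in[1,t]$ with $(I,j)\models\beta$ and $(I,k)\models\alpha$ for all $k\in[j+1,t]$. A semiautomaton is $\langle\Sigma,Q,\delta\rangle$, $\delta:Q\times\Sigma\to Q$; it is trivial if $|Q|=1$. The composition of an input function $\phi:\Sigma\to\Pi$ with $\langle\Pi,Q,\delta\rangle$ is $\langle\Sigma,Q,\delta_\phi\rangle$ with $\delta_\phi(q,\sigma)=\delta(q,\phi(\sigma))$. A flip-flop semiautomaton is (isomorphic to) the canonical flip-flop: inputs $\{set,reset,read\}$, states $\{high,low\}$, $\delta(q,read)=q$, $\delta(q,set)=high$, $\delta(q,reset)=low$. An automaton is $\langle\Sigma,Q,\delta,q_{\mathrm{init}},\Gamma,\theta\rangle$ with semiautomaton $\langle\Sigma,Q,\delta\rangle$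 and $\theta:Q\times\Sigma\to\Gamma$; on $\sigma_1\dots\sigma_\ell$ its states are $q_0=q_{\mathrm{init}}$, $q_i=\delta(q_{i-1},\sigma_i)$ and upon reading $\sigma_i$ it outputs $\theta(q_{i-1},\sigma_i)$; it is trivial if its semiautomaton is. An automaton on assignments has $\Sigma=\{0,1\}^m$, $\Gamma=\{0,1\}^k$ read as assignments to ordered input and output variables; $(A,I,t)\vdash b$ iff the output upon reading the $t$-th letter assigns $1$ to $b$. An automata cascade $A_1\ltimes\dots\ltimes A_d$ of automata $A_i=\langle\Sigma_i,Q_i,\delta_i,q^{\mathrm{init}}_i,\Gamma_i,\theta_i\rangle$ with $\Sigma_i=\Sigma\times\Gamma_1\times\dots\times\Gamma_{i-1}$ is the automaton with input alphabet $\Sigma$, states $Q_1\times\dots\times Q_d$, initial state $\langle q^{\mathrm{init}}_1,\dots,q^{\mathrm{init}}_d\rangle$, transition $\delta(\langle q_1,\dots,q_d\rangle,\sigma)=\langle\delta_1(q_1,\sigma_1),\dots,\delta_d(q_d,\sigma_d)\rangle$ with $\sigma_i=\langle\sigma,\theta_1(q_1,\sigma_1),\dots,\theta_{i-1}(q_{i-1},\sigma_{i-1})\rangle$, and output $\theta_d(q_d,\sigma_d)$. -}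

module Defs where

open import Data.Nat using (ℕ; zero; suc; _+_)
open import Data.Bool using (Bool; true; false)
open import Data.Fin using (Fin; toℕ) renaming (_≤_ to _≤ᶠ_; _<_ to _<ᶠ_)
open import Data.Vec using (Vec; lookup; toList)
open import Data.List using (List; take; foldl)
open import Data.Product using (Σ; _×_; _,_; proj₁; proj₂)
open import Data.Sum using (_⊎_)
open import Data.Unit using (⊤)
open import Data.Empty using (⊥)
open import Relation.Nullary using (¬_)
open import Relation.Binary.PropositionalEquality using (_≡_)
open import Function.Bundles using (_⤖_; Bijection)

infixr 6 _∧_
infixr 5 _∨_
infixr 7 _S_

data Formula (m : ℕ) : Set where
  var     : Fin m → Formula m
  ⊤f ⊥f   : Formula m
  ¬f_     : Formula m → Formula m
  _∧_ _∨_ : Formula m → Formula m → Formula m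
  ⊖_      : Formula m → Formula m
  _S_     : Formula m → Formula m → Formula m

size : ∀ {m} → Formula m → ℕ
size (var _)  = 1
size ⊤f       = 1
size ⊥f       = 1
size (¬f α)   = suc (size α)
size (α ∧ β)  = suc (size α + size β)
size (α ∨ β)  = suc (size α + size β)
size (⊖ α)    = suc (size α)
size (α S β)  = suc (size α + size β)

Assignment : ℕ → Set
Assignment n = Vec Bool n

-- Time points are t : Fin ℓ, where the
-- Agda index t stands for the paper's time point toℕ t + 1.
Interpretation : ℕ → ℕ → Set
Interpretation m ℓ = Vec (Assignment m) ℓ

Sat : ∀ {m ℓ} → Interpretation m ℓ → Fin ℓ → Formula m → Set
Sat I t (var a)  = lookup (lookup I t) a ≡ true
Sat I t ⊤f     = ⊤
Sat I t ⊥f     = ⊥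
Sat I t (¬f α)   = ¬ (Sat I t α)
Sat I t (α ∧ β)  = (Sat I t α) × (Sat I t β)
Sat I t (α ∨ β)  = (Sat I t α) ⊎ (Sat I t β)
Sat I t (⊖ α)    = Σ (Fin _) λ s → (suc (toℕ s) ≡ toℕ t) × (Sat I s α)
Sat I t (α S β)  = Σ (Fin _) λ j → (j ≤ᶠ t) × (Sat I j β)
                   × (∀ k → j <ᶠ k → k ≤ᶠ t → Sat I k α)

record Semiautomaton : Set₁ where
  constructor ⟨_,_,_⟩
  field
    Alph  : Set
    State : Set
    δ     : State → Alph → State

TrivialSA : Semiautomaton → Set
TrivialSA Sa = Semiautomaton.State Sa ⤖ Fin 1

data FFInput : Set where
  set reset read : FFInput

data FFState : Set where
  high low : FFState

ffδ : FFState → FFInput → FFState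
ffδ q read  = q
ffδ q set   = high
ffδ q reset = low

canonicalFF : Semiautomaton
canonicalFF = ⟨ FFInput , FFState , ffδ ⟩

_≅SA_ : Semiautomaton → Semiautomaton → Set
Sa ≅SA T = Σ (Semiautomaton.Alph Sa ⤖ Semiautomaton.Alph T) λ f →
          Σ (Semiautomaton.State Sa ⤖ Semiautomaton.State T) λ g →
            ∀ q σ → Bijection.to g (Semiautomaton.δ Sa q σ)
                    ≡ Semiautomaton.δ T (Bijection.to g q) (Bijection.to f σ)

IsFlipFlop : Semiautomaton → Set
IsFlipFlop Sa = Sa ≅SA canonicalFF

compose : {Σ′ : Set} (Sa : Semiautomaton) → (Σ′ → Semiautomaton.Alph Sa) → Semiautomaton
compose {Σ′} Sa φ = ⟨ Σ′ , Semiautomaton.State Sa , (λ q σ → Semiautomaton.δ Sa q (φ σ)) ⟩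

-- Sa is a flip-flop semiautomaton composed with an input function
-- (equality of semiautomata with the same alphabet and state set,
-- i.e. pointwise equality of the transition functions)
IsFFComposed : Semiautomaton → Set₁
IsFFComposed Sa =
  Σ Set λ Π →
  Σ (Semiautomaton.State Sa → Π → Semiautomaton.State Sa) λ δ′ →
  Σ (Semiautomaton.Alph Sa → Π) λ φ →
    IsFlipFlop ⟨ Π , Semiautomaton.State Sa , δ′ ⟩ ×
    (∀ q σ → Semiautomaton.δ Sa q σ
             ≡ Semiautomaton.δ (compose ⟨ Π , Semiautomaton.State Sa , δ′ ⟩ φ) q σ)

record Automaton (Σ′ Γ : Set) : Set₁ where
  field
    Q     : Set
    δ     : Q → Σ′ → Q
    qinit : Q
    θ     : Q → Σ′ → Γ

semi : ∀ {Σ′ Γ} → Automaton Σ′ Γ → Semiautomaton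
semi {Σ′} A = ⟨ Σ′ , Automaton.Q A , Automaton.δ A ⟩

run : ∀ {Σ′ Γ} (A : Automaton Σ′ Γ) → List Σ′ → Automaton.Q A
run A w = foldl (Automaton.δ A) (Automaton.qinit A) w

-- output upon reading the t-th letter of a word: θ(q_{t-1}, σ_t)
outputAt : ∀ {Σ′ Γ ℓ} → Automaton Σ′ Γ → Vec Σ′ ℓ → Fin ℓ → Γ
outputAt A w t = Automaton.θ A (run A (take (toℕ t) (toList w))) (lookup w t)

Derives : ∀ {m k ℓ} → Automaton (Assignment m) (Assignment k)
          → Interpretation m ℓ → Fin ℓ → Fin k → Set
Derives A I t b = lookup (outputAt A I t) b ≡ true

-- Cascade Σ d E k : a cascade of d components over input alphabet Σ, where
-- E = Σ × Γ_1 × ... × Γ_d (nested to the left) is the input alphabet that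
-- a further component would receive, and the last component outputs
-- assignments Γ_d = {0,1}^k.

data Cascade (Σ′ : Set) : ℕ → Set → ℕ → Set₁ where
  first : ∀ {k} → Automaton Σ′ (Assignment k)
        → Cascade Σ′ 1 (Σ′ × Assignment k) k
  next  : ∀ {d E k k′} → Cascade Σ′ d E k → Automaton E (Assignment k′)
        → Cascade Σ′ (suc d) (E × Assignment k′) k′

CState : ∀ {Σ′ d E k} → Cascade Σ′ d E k → Set
CState (first A)  = Automaton.Q A
CState (next C A) = CState C × Automaton.Q A

cinit : ∀ {Σ′ d E k} (C : Cascade Σ′ d E k) → CState C
cinit (first A)  = Automaton.qinit A
cinit (next C A) = cinit C , Automaton.qinit A

cext : ∀ {Σ′ d E k} (C : Cascade Σ′ d E k) → CState C → Σ′ → E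
cext (first A) q σ = σ , Automaton.θ A q σ
cext (next C A) (s , q) σ = let e = cext C s σ in e , Automaton.θ A q e

cδ : ∀ {Σ′ d E k} (C : Cascade Σ′ d E k) → CState C → Σ′ → CState C
cδ (first A) q σ = Automaton.δ A q σ
cδ (next C A) (s , q) σ = cδ C s σ , Automaton.δ A q (cext C s σ)

cθ : ∀ {Σ′ d E k} (C : Cascade Σ′ d E k) → CState C → Σ′ → Assignment k
cθ (first A) q σ = Automaton.θ A q σ
cθ (next C A) (s , q) σ = Automaton.θ A q (cext C s σ)

cascadeAutomaton : ∀ {Σ′ d E k} → Cascade Σ′ d E k → Automaton Σ′ (Assignment k)
cascadeAutomaton C = record { Q = CState C ; δ = cδ C ; qinit = cinit C ; θ = cθ C }

AllComponents : (∀ {Σ′ Γ} → Automaton Σ′ Γ → Set₁)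
              → ∀ {Σ′ d E k} → Cascade Σ′ d E k → Set₁
AllComponents P (first A)  = P A
AllComponents P (next C A) = AllComponents P C × P A

GoodComponent : ∀ {Σ′ Γ} → Automaton Σ′ Γ → Set₁
GoodComponent A = Lift′ (TrivialSA (semi A)) ⊎ IsFFComposed (semi A)
  where
  open import Level using (Lift)
  Lift′ : Set → Set₁
  Lift′ X = Lift _ X

{-# OPTIONS --safe #-}
-- Compile φ bottom-up, appending one component per node of its syntax tree to a
-- one-component trivial cascade (hence 1 + |φ| ≤ 2|φ| components).  A component reads the original letter together
-- with the outputs of all earlier components, hence the truth values of the immediate
-- subformulas at the current time, and outputs the truth value of its own subformula.
-- Boolean connectives and variables need no memory (trivial components).  For ⊖α a
-- flip-flop is set when α holds and reset otherwise, so it is high exactly when α held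
-- one step before.  For α S β a flip-flop is set when β holds, kept when only α holds
-- and reset otherwise; by the recurrence  α S β ≡ β ∨ (α ∧ ⊖(α S β))  it is high
-- exactly when α S β held one step before, and the component outputs β ∨ (α ∧ high).
module Submission where

open import Defs
open import Data.Nat using (ℕ; _≤_; _*_)
open import Data.Bool using (Bool)
open import Data.Fin using (Fin)
open import Data.Vec using (Vec)
open import Data.Product using (Σ; _×_)
open import Function.Bundles using (_⇔_)

open import Data.Nat using (zero; suc; _+_; s≤s; z≤n)
open import Data.Nat.Properties using (suc-injective; <⇒≱; +-monoʳ-≤; +-identityʳ)
open import Data.Bool using (true; false; T; not) renaming (_∧_ to _&&_; _∨_ to _||_)
open import Data.Bool.Properties using (T-≡; T-∧; T-∨; ∨-identityʳ)
open import Data.Fin using (zero; suc; toℕ; inject₁) renaming (_≤_ to _≤ᶠ_; _<_ to _<ᶠ_)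
open import Data.Fin.Properties
  using (toℕ-injective; toℕ-inject₁; _≟_; ≤-refl; ≤∧≢⇒<; <⇒≤pred; i≤inject₁[j]⇒i≤1+j; 1↔⊤)
open import Data.Fin.Induction using (<-weakInduction)
open import Data.Vec using ([]; _∷_; lookup; toList)
open import Data.List using (take; foldl) renaming ([] to []ᴸ; _∷_ to _∷ᴸ_)
open import Data.Product using (_,_; proj₁; proj₂)
open import Data.Product.Function.NonDependent.Propositional using (_×-⇔_)
open import Data.Sum using (_⊎_; inj₁; inj₂; [_,_])
open import Data.Sum.Function.Propositional using (_⊎-⇔_)
open import Data.Unit using (⊤; tt)
open import Data.Empty using (⊥-elim)
open import Function.Base using (id; _∘_; const)
open import Function.Bundles using (mk⇔; Equivalence)
open import Function.Construct.Composition using (_⇔-∘_)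
open import Function.Construct.Identity using (⇔-id; ⤖-id)
open import Function.Construct.Symmetry using (⇔-sym; ↔-sym)
open import Function.Properties.Inverse using (↔⇒⤖)
open import Function.Related.Propositional using (module EquationalReasoning; equivalence)
open import Function.Related.TypeIsomorphisms using (¬-cong-⇔)
open import Level using (lift)
open import Relation.Nullary using (¬_; yes; no)
open import Relation.Binary.PropositionalEquality
  using (_≡_; refl; sym; trans; cong; subst; module ≡-Reasoning)

private variable
  Σ′ E E′ : Set
  d d′ j k k′ ℓ m n : ℕ

T-not : (b : Bool) → T (not b) ⇔ (¬ T b)
T-not true = mk⇔ (λ ()) (λ ¬⊤ → ¬⊤ tt)
T-not false = mk⇔ (λ _ ()) (λ _ → tt)

-- Past operators on arbitrary predicates over time points; Sat I t (⊖ α) and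
-- Sat I t (α S β) are definitionally instances of them.

Previous : (Fin ℓ → Set) → Fin ℓ → Set
Previous P t = Σ (Fin _) λ s → (suc (toℕ s) ≡ toℕ t) × P s

Since : (Fin ℓ → Set) → (Fin ℓ → Set) → Fin ℓ → Set
Since P Q t = Σ (Fin _) λ j → (j ≤ᶠ t) × Q j × (∀ k → j <ᶠ k → k ≤ᶠ t → P k)

module _ {P : Fin (suc n) → Set} where

  previous-zero : ¬ Previous P zero
  previous-zero (_ , () , _)

  previous-suc : (i : Fin n) → Previous P (suc i) ⇔ P (inject₁ i)
  previous-suc i = mk⇔
    (λ (s , 1+s≡1+i , p) → subst P (toℕ-injective (trans (suc-injective 1+s≡1+i) (sym (toℕ-inject₁ i)))) p)
    (λ p → inject₁ i , cong suc (toℕ-inject₁ i) , p)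

module _ {P Q : Fin (suc n) → Set} where

  since-zero : Since P Q zero ⇔ Q zero
  since-zero = mk⇔ (λ { (zero , _ , q , _) → q ; (suc _ , () , _) })
                   (λ q → zero , z≤n , q , λ { zero () _ ; (suc _) _ () })

  since-suc : (i : Fin n) → Since P Q (suc i) ⇔ (Q (suc i) ⊎ (P (suc i) × Since P Q (inject₁ i)))
  since-suc i = mk⇔ unfold fold
    where
    unfold : Since P Q (suc i) → Q (suc i) ⊎ (P (suc i) × Since P Q (inject₁ i))
    unfold (j , j≤t , q , p) with j ≟ suc i
    ... | yes refl = inj₁ q
    ... | no j≢t = inj₂ (p (suc i) j<t ≤-refl , j , <⇒≤pred j<t , q ,
                         λ k j<k k≤i → p k j<k (i≤inject₁[j]⇒i≤1+j k≤i))
      where j<t = ≤∧≢⇒< j≤t j≢t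
    fold : Q (suc i) ⊎ (P (suc i) × Since P Q (inject₁ i)) → Since P Q (suc i)
    fold (inj₁ q) = suc i , ≤-refl , q , λ k t<k k≤t → ⊥-elim (<⇒≱ t<k k≤t)
    fold (inj₂ (pt , j , j≤i , q , p)) = j , i≤inject₁[j]⇒i≤1+j j≤i , q , hold
      where
      hold : ∀ k → j <ᶠ k → k ≤ᶠ suc i → P k
      hold k j<k k≤t with k ≟ suc i
      ... | yes refl = pt
      ... | no k≢t = p k j<k (<⇒≤pred (≤∧≢⇒< k≤t k≢t))

since-unfold : {P Q : Fin ℓ → Set} (t : Fin ℓ) →
               Since P Q t ⇔ (Q t ⊎ (P t × Previous (Since P Q) t))
since-unfold {P = P} {Q} zero =
  mk⇔ (inj₁ ∘ Equivalence.to zero-case)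
      [ Equivalence.from zero-case , ⊥-elim ∘ previous-zero {P = Since P Q} ∘ proj₂ ]
  where zero-case = since-zero {P = P} {Q}
since-unfold {P = P} {Q} (suc i) =
  (⇔-id _ ⊎-⇔ (⇔-id _ ×-⇔ ⇔-sym (previous-suc i))) ⇔-∘ since-suc {P = P} {Q} i

foldl-fusion : ∀ {A B C : Set} (h : B → C) {f : B → A → B} {g : C → A → C} →
               (∀ x y → h (f x y) ≡ g (h x) y) → ∀ x xs → h (foldl f x xs) ≡ foldl g (h x) xs
foldl-fusion h fuse x []ᴸ = refl
foldl-fusion h {f} {g} fuse x (y ∷ᴸ ys) =
  trans (foldl-fusion h fuse (f x y) ys) (cong (λ z → foldl g z ys) (fuse x y))

foldl-take-suc : ∀ {A B : Set} (f : B → A → B) (z : B) (w : Vec A ℓ) (t : Fin ℓ) →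
                 foldl f z (take (suc (toℕ t)) (toList w))
                   ≡ f (foldl f z (take (toℕ t) (toList w))) (lookup w t)
foldl-take-suc f z (x ∷ w) zero = refl
foldl-take-suc f z (x ∷ w) (suc t) = foldl-take-suc f (f z x) w t

stateAfter : (C : Cascade Σ′ d E k) → Vec Σ′ ℓ → ℕ → CState C
stateAfter C w n = run (cascadeAutomaton C) (take n (toList w))

-- the letter ⟨σ_t, outputs of all components of C⟩ that a component appended to C reads at time t
extendedLetter : (C : Cascade Σ′ d E k) → Vec Σ′ ℓ → Fin ℓ → E
extendedLetter C w t = cext C (stateAfter C w (toℕ t)) (lookup w t)

stateAfter-suc : (C : Cascade Σ′ d E k) (w : Vec Σ′ (suc ℓ)) (i : Fin ℓ) →
                 stateAfter C w (toℕ (suc i))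
                   ≡ cδ C (stateAfter C w (toℕ (inject₁ i))) (lookup w (inject₁ i))
stateAfter-suc C w i = begin
  stateAfter C w (suc (toℕ i))            ≡⟨ cong (stateAfter C w ∘ suc) (sym (toℕ-inject₁ i)) ⟩
  stateAfter C w (suc (toℕ (inject₁ i)))  ≡⟨ foldl-take-suc (cδ C) (cinit C) w (inject₁ i) ⟩
  cδ C (stateAfter C w (toℕ (inject₁ i))) (lookup w (inject₁ i)) ∎
  where open ≡-Reasoning

module _ (C : Cascade Σ′ d E k) (A : Automaton E (Assignment j)) where

  componentState : Vec Σ′ ℓ → Fin ℓ → Automaton.Q A
  componentState w t = proj₂ (stateAfter (next C A) w (toℕ t))

  stateAfter-next : (w : Vec Σ′ ℓ) (n : ℕ) → proj₁ (stateAfter (next C A) w n) ≡ stateAfter C w n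
  stateAfter-next w n = foldl-fusion proj₁ (λ _ _ → refl) (cinit (next C A)) (take n (toList w))

  extendedLetter-next : (w : Vec Σ′ ℓ) (t : Fin ℓ) →
    extendedLetter (next C A) w t
      ≡ (extendedLetter C w t , Automaton.θ A (componentState w t) (extendedLetter C w t))
  extendedLetter-next w t =
    cong (λ s → cext C s (lookup w t) , Automaton.θ A (componentState w t) (cext C s (lookup w t)))
         (stateAfter-next w (toℕ t))

  componentState-suc : (w : Vec Σ′ (suc ℓ)) (i : Fin ℓ) →
    componentState w (suc i) ≡ Automaton.δ A (componentState w (inject₁ i)) (extendedLetter C w (inject₁ i))
  componentState-suc w i =
    trans (cong proj₂ (stateAfter-suc (next C A) w i))
          (cong (λ s → Automaton.δ A (componentState w (inject₁ i)) (cext C s (lookup w (inject₁ i))))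
                (stateAfter-next w (toℕ (inject₁ i))))

input : Cascade Σ′ d E k → E → Σ′
input (first A) = proj₁
input (next C A) = input C ∘ proj₁

input-extendedLetter : (C : Cascade Σ′ d E k) (w : Vec Σ′ ℓ) (t : Fin ℓ) →
                       input C (extendedLetter C w t) ≡ lookup w t
input-extendedLetter (first A) w t = refl
input-extendedLetter (next C A) w t =
  trans (cong (input C ∘ proj₁) (extendedLetter-next C A w t)) (input-extendedLetter C w t)

output : Cascade Σ′ d E k → E → Assignment k
output (first A) = proj₂
output (next C A) = proj₂

outputBit : Cascade Σ′ d E 1 → E → Bool
outputBit C e = lookup (output C e) zero

derives-outputBit : (C : Cascade (Assignment m) d E 1) (I : Interpretation m ℓ) (t : Fin ℓ) →
                    T (outputBit C (extendedLetter C I t)) ⇔ Derives (cascadeAutomaton C) I t zero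
derives-outputBit (first A) I t = T-≡
derives-outputBit (next C A) I t = T-≡

data Extension (C : Cascade Σ′ d E k) : ∀ {d′ E′ k′} → ℕ → Cascade Σ′ d′ E′ k′ → Set₁ where
  done : Extension C 0 C
  snoc : {C′ : Cascade Σ′ d′ E′ k′} → Extension C n C′ →
         (A : Automaton E′ (Assignment j)) → GoodComponent A → Extension C (suc n) (next C′ A)

module _ {C : Cascade Σ′ d E k} where

  _++_ : ∀ {C₁ : Cascade Σ′ d′ E′ k′} {d″ E″ k″ n′} {C₂ : Cascade Σ′ d″ E″ k″} →
         Extension C n C₁ → Extension C₁ n′ C₂ → Extension C (n′ + n) C₂
  x ++ done = x
  x ++ snoc y A good = snoc (x ++ y) A good

  extension-depth : {C′ : Cascade Σ′ d′ E′ k′} → Extension C n C′ → d′ ≡ n + d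
  extension-depth done = refl
  extension-depth (snoc x A _) = cong suc (extension-depth x)

  extension-good : {C′ : Cascade Σ′ d′ E′ k′} →
                   AllComponents GoodComponent C → Extension C n C′ → AllComponents GoodComponent C′
  extension-good good done = good
  extension-good good (snoc x A goodA) = extension-good good x , goodA

  restrict : {C′ : Cascade Σ′ d′ E′ k′} → Extension C n C′ → E′ → E
  restrict done = id
  restrict (snoc x A _) = restrict x ∘ proj₁

  restrict-extendedLetter : {C′ : Cascade Σ′ d′ E′ k′} (x : Extension C n C′)
                            (w : Vec Σ′ ℓ) (t : Fin ℓ) →
                            restrict x (extendedLetter C′ w t) ≡ extendedLetter C w t
  restrict-extendedLetter done w t = refl
  restrict-extendedLetter (snoc {C′ = C′} x A _) w t =
    trans (cong (restrict x ∘ proj₁) (extendedLetter-next C′ A w t)) (restrict-extendedLetter x w t)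

Observes : Cascade (Assignment m) d E k → (E → Bool) → Formula m → Set
Observes {m = m} C g φ = ∀ {ℓ} (I : Interpretation m ℓ) t → T (g (extendedLetter C I t)) ⇔ Sat I t φ

restrict-observes : {C : Cascade (Assignment m) d E k} {C′ : Cascade (Assignment m) d′ E′ k′}
                    (x : Extension C n C′) (g : E → Bool) {φ : Formula m} →
                    Observes C g φ → Observes C′ (g ∘ restrict x) φ
restrict-observes x g {φ} obs I t =
  subst (λ e → T (g e) ⇔ Sat I t φ) (sym (restrict-extendedLetter x I t)) (obs I t)

observes-next : (C : Cascade (Assignment m) d E k) (A : Automaton E (Assignment 1)) {φ : Formula m} →
  (∀ {ℓ} (I : Interpretation m ℓ) t →
     T (lookup (Automaton.θ A (componentState C A I t) (extendedLetter C I t)) zero) ⇔ Sat I t φ) →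
  Observes (next C A) (outputBit (next C A)) φ
observes-next C A {φ} h I t =
  subst (λ e → T (lookup (proj₂ e) zero) ⇔ Sat I t φ) (sym (extendedLetter-next C A I t)) (h I t)

stateless : (E → Assignment k) → Automaton E (Assignment k)
stateless f = record { Q = ⊤ ; δ = λ _ _ → tt ; qinit = tt ; θ = λ _ → f }

stateless-good : (f : E → Assignment k) → GoodComponent (stateless f)
stateless-good f = inj₁ (lift (↔⇒⤖ (↔-sym 1↔⊤)))

gate : (E → Bool) → Automaton E (Assignment 1)
gate g = stateless (λ e → g e ∷ [])

gate-good : (g : E → Bool) → GoodComponent (gate g)
gate-good g = stateless-good (λ e → g e ∷ [])

gate-observes : (C : Cascade (Assignment m) d E k) (g : E → Bool) {φ : Formula m} →
                Observes C g φ → Observes (next C (gate g)) (outputBit (next C (gate g))) φ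
gate-observes C g = observes-next C (gate g)

isHigh : FFState → Bool
isHigh high = true
isHigh low = false

latch : Bool → Bool → FFInput
latch true _ = set
latch false true = read
latch false false = reset

isHigh-latch : ∀ q x y → isHigh (ffδ q (latch x y)) ≡ x || (y && isHigh q)
isHigh-latch q true y = refl
isHigh-latch q false true = refl
isHigh-latch q false false = refl

flipFlop : (E → FFInput) → (FFState → E → Bool) → Automaton E (Assignment 1)
flipFlop control out =
  record { Q = FFState ; δ = λ q e → ffδ q (control e) ; qinit = low ; θ = λ q e → out q e ∷ [] }

flipFlop-good : (control : E → FFInput) (out : FFState → E → Bool) → GoodComponent (flipFlop control out)
flipFlop-good control out =
  inj₂ (FFInput , ffδ , control , (⤖-id _ , ⤖-id _ , λ _ _ → refl) , λ _ _ → refl)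

previousComponent : (E → Bool) → Automaton E (Assignment 1)
previousComponent g = flipFlop (λ e → latch (g e) false) (λ q _ → isHigh q)

previousComponent-good : (g : E → Bool) → GoodComponent (previousComponent g)
previousComponent-good g = flipFlop-good (λ e → latch (g e) false) (λ q _ → isHigh q)

sinceComponent : (E → Bool) → (E → Bool) → Automaton E (Assignment 1)
sinceComponent gα gβ = flipFlop (λ e → latch (gβ e) (gα e)) (λ q e → gβ e || (gα e && isHigh q))

sinceComponent-good : (gα gβ : E → Bool) → GoodComponent (sinceComponent gα gβ)
sinceComponent-good gα gβ = flipFlop-good (λ e → latch (gβ e) (gα e)) (λ q e → gβ e || (gα e && isHigh q))

module _ (C : Cascade (Assignment m) d E k) (g : E → Bool) {α : Formula m} (obs : Observes C g α) where
  open EquationalReasoning {k = equivalence}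

  previousComponent-high : (I : Interpretation m ℓ) (t : Fin ℓ) →
    T (isHigh (componentState C (previousComponent g) I t)) ⇔ Previous (λ s → Sat I s α) t
  previousComponent-high I zero = mk⇔ (λ ()) previous-zero
  previousComponent-high I (suc i) = begin
    T (isHigh (componentState C (previousComponent g) I (suc i)))
      ≡⟨ cong (T ∘ isHigh) (componentState-suc C (previousComponent g) I i) ⟩
    T (isHigh (ffδ q (latch (g e) false)))
      ≡⟨ cong T (trans (isHigh-latch q (g e) false) (∨-identityʳ (g e))) ⟩
    T (g e)                             ∼⟨ obs I (inject₁ i) ⟩
    Sat I (inject₁ i) α                 ∼⟨ ⇔-sym (previous-suc i) ⟩
    Previous (λ s → Sat I s α) (suc i)  ∎
    where
    q = componentState C (previousComponent g) I (inject₁ i)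
    e = extendedLetter C I (inject₁ i)

  previousComponent-observes :
    Observes (next C (previousComponent g)) (outputBit (next C (previousComponent g))) (⊖ α)
  previousComponent-observes = observes-next C (previousComponent g) {⊖ α} previousComponent-high

module _ (C : Cascade (Assignment m) d E k) (gα gβ : E → Bool) {α β : Formula m}
         (obsα : Observes C gα α) (obsβ : Observes C gβ β) where
  open EquationalReasoning {k = equivalence}

  since-observed : (I : Interpretation m ℓ) (t : Fin ℓ) {b : Bool} →
    T b ⇔ Previous (λ s → Sat I s (α S β)) t →
    T (gβ (extendedLetter C I t) || (gα (extendedLetter C I t) && b)) ⇔ Sat I t (α S β)
  since-observed I t {b} tracked = begin
    T (gβ e || (gα e && b))         ∼⟨ T-∨ ⟩
    (T (gβ e) ⊎ T (gα e && b))      ∼⟨ ⇔-id _ ⊎-⇔ T-∧ ⟩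
    (T (gβ e) ⊎ (T (gα e) × T b))   ∼⟨ obsβ I t ⊎-⇔ (obsα I t ×-⇔ tracked) ⟩
    (Sat I t β ⊎ (Sat I t α × Previous (λ s → Sat I s (α S β)) t))  ∼⟨ ⇔-sym (since-unfold t) ⟩
    Sat I t (α S β)                 ∎
    where e = extendedLetter C I t

  RecordsPreviousSince : Interpretation m ℓ → Fin ℓ → Set
  RecordsPreviousSince I t =
    T (isHigh (componentState C (sinceComponent gα gβ) I t)) ⇔ Previous (λ s → Sat I s (α S β)) t

  sinceComponent-high : (I : Interpretation m ℓ) (t : Fin ℓ) → RecordsPreviousSince I t
  sinceComponent-high {ℓ = suc _} I = <-weakInduction (RecordsPreviousSince I) (mk⇔ (λ ()) previous-zero) step
    where
    step : ∀ i → RecordsPreviousSince I (inject₁ i) → RecordsPreviousSince I (suc i)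
    step i tracked = begin
      T (isHigh (componentState C (sinceComponent gα gβ) I (suc i)))
        ≡⟨ cong (T ∘ isHigh) (componentState-suc C (sinceComponent gα gβ) I i) ⟩
      T (isHigh (ffδ q (latch (gβ e) (gα e))))  ≡⟨ cong T (isHigh-latch q (gβ e) (gα e)) ⟩
      T (gβ e || (gα e && isHigh q))            ∼⟨ since-observed I (inject₁ i) tracked ⟩
      Sat I (inject₁ i) (α S β)                 ∼⟨ ⇔-sym (previous-suc i) ⟩
      Previous (λ s → Sat I s (α S β)) (suc i)  ∎
      where
      q = componentState C (sinceComponent gα gβ) I (inject₁ i)
      e = extendedLetter C I (inject₁ i)

  sinceComponent-observes :
    Observes (next C (sinceComponent gα gβ)) (outputBit (next C (sinceComponent gα gβ))) (α S β)
  sinceComponent-observes =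
    observes-next C (sinceComponent gα gβ) {α S β} λ I t → since-observed I t (sinceComponent-high I t)

record Compiled (C : Cascade (Assignment m) d E k) (φ : Formula m) : Set₁ where
  constructor compiled
  field
    {depth} : ℕ
    {Letter} : Set
    {cascade} : Cascade (Assignment m) depth Letter 1
    extension : Extension C (size φ) cascade
    observes : Observes cascade (outputBit cascade) φ

module _ {C : Cascade (Assignment m) d E k} where

  var-compiled : (a : Fin m) → Compiled C (var a)
  var-compiled a = compiled (snoc done (gate g) (gate-good g)) (gate-observes C g observed)
    where
    g : E → Bool
    g e = lookup (input C e) a
    observed : Observes C g (var a)
    observed I t = subst (λ σ → T (lookup σ a) ⇔ Sat I t (var a)) (sym (input-extendedLetter C I t)) T-≡

  ⊤-compiled : Compiled C ⊤f
  ⊤-compiled = compiled (snoc done (gate (const true)) (gate-good (const true)))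
                        (gate-observes C (const true) λ _ _ → ⇔-id _)

  ⊥-compiled : Compiled C ⊥f
  ⊥-compiled = compiled (snoc done (gate (const false)) (gate-good (const false)))
                        (gate-observes C (const false) λ _ _ → ⇔-id _)

  ¬-compiled : {α : Formula m} → Compiled C α → Compiled C (¬f α)
  ¬-compiled (compiled {cascade = Cα} x obs) =
    compiled (snoc x (gate g) (gate-good g)) (gate-observes Cα g λ I t → ¬-cong-⇔ (obs I t) ⇔-∘ T-not _)
    where g = not ∘ outputBit Cα

  ⊖-compiled : {α : Formula m} → Compiled C α → Compiled C (⊖ α)
  ⊖-compiled (compiled {cascade = Cα} x obs) =
    compiled (snoc x (previousComponent g) (previousComponent-good g)) (previousComponent-observes Cα g obs)
    where g = outputBit Cα

  module _ {α β : Formula m} (rβ : Compiled C β) (rα : Compiled (Compiled.cascade rβ) α) where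
    open Compiled rβ using () renaming (cascade to Cβ; extension to xβ; observes to obsβ)
    open Compiled rα using () renaming (cascade to Cα; extension to xα; observes to obsα)

    private
      gβ : _ → Bool
      gβ = outputBit Cβ ∘ restrict xα

      obsβ′ : Observes Cα gβ β
      obsβ′ = restrict-observes xα (outputBit Cβ) obsβ

    ∧-compiled : Compiled C (α ∧ β)
    ∧-compiled = compiled (snoc (xβ ++ xα) (gate g) (gate-good g))
                          (gate-observes Cα g {α ∧ β} λ I t → (obsα I t ×-⇔ obsβ′ I t) ⇔-∘ T-∧)
      where g = λ e → outputBit Cα e && gβ e

    ∨-compiled : Compiled C (α ∨ β)
    ∨-compiled = compiled (snoc (xβ ++ xα) (gate g) (gate-good g))
                          (gate-observes Cα g {α ∨ β} λ I t → (obsα I t ⊎-⇔ obsβ′ I t) ⇔-∘ T-∨)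
      where g = λ e → outputBit Cα e || gβ e

    S-compiled : Compiled C (α S β)
    S-compiled = compiled (snoc (xβ ++ xα) (sinceComponent gα gβ) (sinceComponent-good gα gβ))
                          (sinceComponent-observes Cα gα gβ obsα obsβ′)
      where gα = outputBit Cα

compile : (φ : Formula m) (C : Cascade (Assignment m) d E k) → Compiled C φ
compile (var a) C = var-compiled a
compile ⊤f C = ⊤-compiled
compile ⊥f C = ⊥-compiled
compile (¬f α) C = ¬-compiled (compile α C)
compile (α ∧ β) C = let rβ = compile β C in ∧-compiled rβ (compile α (Compiled.cascade rβ))
compile (α ∨ β) C = let rβ = compile β C in ∨-compiled rβ (compile α (Compiled.cascade rβ))
compile (⊖ α) C = ⊖-compiled (compile α C)
compile (α S β) C = let rβ = compile β C in S-compiled rβ (compile α (Compiled.cascade rβ))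

trivialCascade : Cascade (Assignment m) 1 (Assignment m × Assignment 0) 0
trivialCascade = first (stateless (const []))

size-positive : (φ : Formula m) → 1 ≤ size φ
size-positive (var _) = s≤s z≤n
size-positive ⊤f = s≤s z≤n
size-positive ⊥f = s≤s z≤n
size-positive (¬f _) = s≤s z≤n
size-positive (_ ∧ _) = s≤s z≤n
size-positive (_ ∨ _) = s≤s z≤n
size-positive (⊖ _) = s≤s z≤n
size-positive (_ S _) = s≤s z≤n

n+1≤2*n : ∀ n → 1 ≤ n → n + 1 ≤ 2 * n
n+1≤2*n n 1≤n = subst (n + 1 ≤_) (cong (n +_) (sym (+-identityʳ n))) (+-monoʳ-≤ n 1≤n)

corollary2 : Σ ℕ λ c → ∀ {m} (φ : Formula m) →
    Σ ℕ λ d → Σ ℕ λ k → Σ Set λ E → Σ (Cascade (Assignment m) d E k) λ C →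
      (d ≤ c * size φ) ×
      AllComponents GoodComponent C ×
      Σ (Fin k) λ a →
        ∀ {ℓ} (I : Interpretation m ℓ) (t : Fin ℓ) →
          Sat I t φ ⇔ Derives (cascadeAutomaton C) I t a
corollary2 = 2 , λ φ → let open Compiled (compile φ trivialCascade) in
  _ , 1 , _ , cascade ,
  subst (_≤ 2 * size φ) (sym (extension-depth extension)) (n+1≤2*n (size φ) (size-positive φ)) ,
  extension-good (stateless-good (const [])) extension ,
  zero , λ I t → derives-outputBit cascade I t ⇔-∘ ⇔-sym (observes I t)
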